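{- Let $\mathbf H$ be a commutative and cocommutative connected Hopf monoid linearized in the basis $\mathbf h$, $I$ a finite set and $x,y\in\mathbf h[I]$ with $\mathcal C_x^y\ne\emptyset$. Then for any $A\in\mathcal C_x^y$ and any minimal element $\Lambda$ of $\mathcal C_x^y$ (under refinement), the interval $[\Lambda,A]=\{B\models I:\Lambda\le B\le A\}$ is contained in $\mathcal C_x^y$.
   Context: Work over a field of characteristic $0$. A connected Hopf monoid in vector species $\mathbf H$ has products $\mu_{A_1,A_2}$ and coproducts $\Delta_{A_1,A_2}$ for ordered decompositions $I=A_1\sqcup A_2$, satisfying associativity, coassociativity and compatibility axioms; commutative and cocommutative mean $\mu$ and $\Delta$ are invariant under swapping the two factors. It is linearized in the basis $\mathbf h$ if products send basis pairs to basis elements and coproducts send basis elements to $0$ or to a tensor of basis elements. A set composition $A=(A_1,\dots,A_k)\models I$ is a sequence of nonempty disjoint subsets with union $I$; $\mu_A,\Delta_A$ are iterated product/coproduct. $A\le B$ if every part of $B$ is a union of consecutive parts of $A$. For $x\in\mathbf h[I]$ with $\Delta_A(x)\ne0$ put $x_A=\mu_A\Delta_A(x)$, and $\mathcal C_x^y=\{A\models I:\Delta_A(x)\ne0,\ x_A=y\}$. (The interval $[\Lambda,A]$ is empty if $\Lambda\not\le A$.) -}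

module Defs where

open import Data.Nat using (ℕ)
open import Data.Fin.Subset using (Subset; _∪_; _∩_; ⊥; ⋃; Nonempty)
open import Data.List using (List; []; _∷_; _++_)
open import Data.List.Relation.Unary.All using (All)
open import Data.List.Relation.Unary.AllPairs using (AllPairs)
open import Data.Maybe using (Maybe; just; nothing; _>>=_)
open import Data.Product using (Σ; _×_; _,_; swap)
open import Relation.Binary.PropositionalEquality using (_≡_)

Disjoint : {n : ℕ} → Subset n → Subset n → Set
Disjoint A B = A ∩ B ≡ ⊥

Decomp : {n : ℕ} → Subset n → Subset n → Subset n → Set
Decomp S A B = Disjoint A B × A ∪ B ≡ S

module _ {H : Set} where
  ⊗μ : (H → H → H) → Maybe (H × H) → Maybe (H × H) → Maybe (H × H)
  ⊗μ m (just (x₁ , x₂)) (just (y₁ , y₂)) = just (m x₁ y₁ , m x₂ y₂)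
  ⊗μ m _ _ = nothing

  Δ⊗id : (H → Maybe (H × H)) → Maybe (H × H) → Maybe (H × H × H)
  Δ⊗id d t = t >>= λ { (u , v) → d u >>= λ { (u₁ , u₂) → just (u₁ , u₂ , v) } }

  id⊗Δ : (H → Maybe (H × H)) → Maybe (H × H) → Maybe (H × H × H)
  id⊗Δ d t = t >>= λ { (u , v) → d v >>= λ { (v₁ , v₂) → just (u , v₁ , v₂) } }

  mapSwap : Maybe (H × H) → Maybe (H × H)
  mapSwap t = t >>= λ p → just (swap p)

-- A connected, commutative and cocommutative Hopf monoid in species,
-- linearized in a basis h, restricted to the subsets of the ground set Fin n.
-- Encoded through its total space of basis elements:
--   H = ⨆_{S ⊆ Fin n} h[S],  sup x = S  iff  x ∈ h[S].
-- μ x y        : the basis element μ_{S,T}(x ⊗ y)   (meaningful for disjoint supports)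
-- Δ A B x      : Δ_{A,B}(x) ∈ h[A] ⊗ h[B]; nothing = 0, just (u , v) = u ⊗ v
--                (meaningful when (A , B) decomposes sup x)
record LinHopf (n : ℕ) : Set₁ where
  field
    H   : Set
    sup : H → Subset n
    μ   : H → H → H
    Δ   : Subset n → Subset n → H → Maybe (H × H)
    one : H
    sup-one    : sup one ≡ ⊥
    one-unique : ∀ x → sup x ≡ ⊥ → x ≡ one
    μ-sup : ∀ x y → Disjoint (sup x) (sup y) → sup (μ x y) ≡ sup x ∪ sup y
    Δ-sup : ∀ A B x u v → Decomp (sup x) A B → Δ A B x ≡ just (u , v) →
            sup u ≡ A × sup v ≡ B
    μ-unitˡ : ∀ x → μ one x ≡ x
    μ-unitʳ : ∀ x → μ x one ≡ x
    Δ-counitˡ : ∀ x → Δ ⊥ (sup x) x ≡ just (one , x)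
    Δ-counitʳ : ∀ x → Δ (sup x) ⊥ x ≡ just (x , one)
    μ-assoc : ∀ x y z → Disjoint (sup x) (sup y) → Disjoint (sup x) (sup z) →
              Disjoint (sup y) (sup z) → μ (μ x y) z ≡ μ x (μ y z)
    μ-comm  : ∀ x y → Disjoint (sup x) (sup y) → μ x y ≡ μ y x
    Δ-coassoc : ∀ A B C x → Disjoint A B → Disjoint A C → Disjoint B C →
                A ∪ B ∪ C ≡ sup x →
                Δ⊗id (Δ A B) (Δ (A ∪ B) C x) ≡ id⊗Δ (Δ B C) (Δ A (B ∪ C) x)
    Δ-cocomm  : ∀ A B x → Decomp (sup x) A B → Δ B A x ≡ mapSwap (Δ A B x)
    compat : ∀ x y C D → Disjoint (sup x) (sup y) →
             Decomp (sup x ∪ sup y) C D →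
             Δ C D (μ x y) ≡
               ⊗μ μ (Δ (sup x ∩ C) (sup x ∩ D) x) (Δ (sup y ∩ C) (sup y ∩ D) y)

IsComposition : {n : ℕ} → Subset n → List (Subset n) → Set
IsComposition S A = All Nonempty A × AllPairs Disjoint A × ⋃ A ≡ S

-- Refinement A ≤ B: every part of B is the union of a block of consecutive
-- (nonempty run of) parts of A.
data _≤C_ {n : ℕ} : List (Subset n) → List (Subset n) → Set where
  []   : [] ≤C []
  step : ∀ C Cs {As Bs} → As ≤C Bs → ((C ∷ Cs) ++ As) ≤C (⋃ (C ∷ Cs) ∷ Bs)

module _ {n : ℕ} (M : LinHopf n) where
  open LinHopf M

  -- iterated coproduct Δ_A (nothing = 0; just list = tensor of basis elements)
  ΔL : List (Subset n) → H → Maybe (List H)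
  ΔL [] x = just []
  ΔL (A ∷ []) x = just (x ∷ [])
  ΔL (A ∷ As@(_ ∷ _)) x = Δstep (Δ A (⋃ As) x) (ΔL As)
    where
    Δstep : Maybe (H × H) → (H → Maybe (List H)) → Maybe (List H)
    Δstep nothing _ = nothing
    Δstep (just (u , v)) rec with rec v
    ... | nothing = nothing
    ... | just us = just (u ∷ us)

  μL : List H → H
  μL [] = one
  μL (u ∷ []) = u
  μL (u ∷ v ∷ us) = μ u (μL (v ∷ us))

  -- A ∈ C_x^y : A ⊨ I (I = sup x), Δ_A(x) ≠ 0 and x_A = μ_A Δ_A(x) = y
  InC : H → H → List (Subset n) → Set
  InC x y A = IsComposition (sup x) A ×
              Σ (List H) (λ us → ΔL A x ≡ just us × μL us ≡ y)

  MinimalC : H → H → List (Subset n) → Set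
  MinimalC x y Λ = InC x y Λ × (∀ B → InC x y B → B ≤C Λ → B ≡ Λ)

-- Let Δ_Λ(x) = ls, so that y = μ_Λ(ls). By coassociativity, Δ_Λ factors
-- through Δ_B for every Λ ≤ B, so Δ_B(x) = bs is nonzero. By the compatibility
-- of μ and Δ, Δ_B(x_A) = Δ_B(x) for every B ≤ A, hence Δ_B(y) = bs. On the other
-- hand, by associativity y = μ_B(gs), where gs multiplies together the entries
-- of ls lying in each part of B, and Δ_B(μ_B(gs)) = gs. Thus bs = gs and
-- x_B = μ_B(bs) = μ_B(gs) = y.
module Submission where

open import Defs
open import Data.Nat using (ℕ)
open import Data.Fin.Subset using (Subset; _∪_; _∩_; ⊥; ⋃)
open import Data.Fin.Subset.Properties
  using (∪-identityˡ; ∪-identityʳ; ∪-assoc; ∩-comm; ∩-idem; ∩-zero; ∩-distribˡ-∪; ∩-distribʳ-∪)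
open import Data.List using (List; []; _∷_; _++_; map)
open import Data.List.Properties using (∷-injective)
open import Data.List.Relation.Unary.All using (All; []; _∷_)
import Data.List.Relation.Unary.All.Properties as All
open import Data.List.Relation.Unary.AllPairs using (AllPairs; []; _∷_)
open import Data.Maybe using (Maybe; just)
open import Data.Maybe.Properties using (just-injective)
open import Data.Product using (_×_; _,_; proj₁; proj₂; ∃-syntax)
open import Data.Product.Properties using (,-injectiveˡ; ,-injectiveʳ)
open import Relation.Binary.PropositionalEquality
  using (_≡_; refl; sym; trans; cong; cong₂; subst; subst₂; module ≡-Reasoning)

module _ {n : ℕ} where

  ⋃-++ : (Xs Ys : List (Subset n)) → ⋃ (Xs ++ Ys) ≡ ⋃ Xs ∪ ⋃ Ys
  ⋃-++ []       Ys = sym (∪-identityˡ (⋃ Ys))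
  ⋃-++ (X ∷ Xs) Ys = trans (cong (X ∪_) (⋃-++ Xs Ys)) (sym (∪-assoc X (⋃ Xs) (⋃ Ys)))

  ≤C-⋃ : {Λ B : List (Subset n)} → Λ ≤C B → ⋃ B ≡ ⋃ Λ
  ≤C-⋃ []                   = refl
  ≤C-⋃ (step C Cs {As} Λ≤B) = trans (cong (⋃ (C ∷ Cs) ∪_) (≤C-⋃ Λ≤B)) (sym (⋃-++ (C ∷ Cs) As))

  Disjoint-sym : {X Y : Subset n} → Disjoint X Y → Disjoint Y X
  Disjoint-sym {X} {Y} X#Y = trans (∩-comm Y X) X#Y

  Disjoint-⋃ʳ : {X : Subset n} {Ys : List (Subset n)} → All (Disjoint X) Ys → Disjoint X (⋃ Ys)
  Disjoint-⋃ʳ {X} []           = proj₂ ∩-zero X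
  Disjoint-⋃ʳ {X} {Y ∷ Ys} (X#Y ∷ X#Ys) =
    trans (∩-distribˡ-∪ X Y (⋃ Ys)) (trans (cong₂ _∪_ X#Y (Disjoint-⋃ʳ X#Ys)) (∪-identityʳ ⊥))

  Disjoint-⋃-++ : (Xs : List (Subset n)) {Ys : List (Subset n)} →
                  AllPairs Disjoint (Xs ++ Ys) → Disjoint (⋃ Xs) (⋃ Ys)
  Disjoint-⋃-++ []       {Ys} _ = proj₁ ∩-zero (⋃ Ys)
  Disjoint-⋃-++ (X ∷ Xs) {Ys} (X# ∷ pd) =
    trans (∩-distribʳ-∪ (⋃ Ys) X (⋃ Xs))
      (trans (cong₂ _∪_ (Disjoint-⋃ʳ (All.++⁻ʳ Xs X#)) (Disjoint-⋃-++ Xs pd))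
             (∪-identityʳ ⊥))

  AllPairs-++⁻ˡ : (Xs : List (Subset n)) {Ys : List (Subset n)} →
                  AllPairs Disjoint (Xs ++ Ys) → AllPairs Disjoint Xs
  AllPairs-++⁻ˡ []       _         = []
  AllPairs-++⁻ˡ (X ∷ Xs) (X# ∷ pd) = All.++⁻ˡ Xs X# ∷ AllPairs-++⁻ˡ Xs pd

  AllPairs-++⁻ʳ : (Xs : List (Subset n)) {Ys : List (Subset n)} →
                  AllPairs Disjoint (Xs ++ Ys) → AllPairs Disjoint Ys
  AllPairs-++⁻ʳ []       pd       = pd
  AllPairs-++⁻ʳ (X ∷ Xs) (_ ∷ pd) = AllPairs-++⁻ʳ Xs pd

module _ {H : Set} (d : H → Maybe (H × H)) {a b c : H} where

  Δ⊗id-just⁺ : ∀ {t p} → t ≡ just (p , c) → d p ≡ just (a , b) → Δ⊗id d t ≡ just (a , b , c)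
  Δ⊗id-just⁺ refl dp≡ rewrite dp≡ = refl

  Δ⊗id-just⁻ : ∀ {t} → Δ⊗id d t ≡ just (a , b , c) → ∃[ p ] t ≡ just (p , c) × d p ≡ just (a , b)
  Δ⊗id-just⁻ {just (p , _)} eq with d p in dp≡
  ... | just _ with eq
  ...   | refl = p , refl , dp≡

  id⊗Δ-just⁺ : ∀ {t q} → t ≡ just (a , q) → d q ≡ just (b , c) → id⊗Δ d t ≡ just (a , b , c)
  id⊗Δ-just⁺ refl dq≡ rewrite dq≡ = refl

  id⊗Δ-just⁻ : ∀ {t} → id⊗Δ d t ≡ just (a , b , c) → ∃[ q ] t ≡ just (a , q) × d q ≡ just (b , c)
  id⊗Δ-just⁻ {just (_ , q)} eq with d q in dq≡
  ... | just _ with eq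
  ...   | refl = q , refl , dq≡

map-++⁻ : {A B : Set} (f : A → B) (xs : List A) (Ys Zs : List B) → map f xs ≡ Ys ++ Zs →
          ∃[ ys ] ∃[ zs ] xs ≡ ys ++ zs × map f ys ≡ Ys × map f zs ≡ Zs
map-++⁻ f xs       []       Zs eq = [] , xs , refl , refl , eq
map-++⁻ f (x ∷ xs) (Y ∷ Ys) Zs eq with ∷-injective eq
... | fx≡Y , eq′ with map-++⁻ f xs Ys Zs eq′
...   | ys , zs , refl , ys≡ , zs≡ = x ∷ ys , zs , refl , cong₂ _∷_ fx≡Y ys≡ , zs≡

module _ {n : ℕ} (M : LinHopf n) where
  open LinHopf M

  Δ-counitʳ′ : ∀ {A x} → A ≡ sup x → Δ A ⊥ x ≡ just (x , one)
  Δ-counitʳ′ refl = Δ-counitʳ _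

  Δ-counitˡ′ : ∀ {A x} → A ≡ sup x → Δ ⊥ A x ≡ just (one , x)
  Δ-counitˡ′ refl = Δ-counitˡ _

  sup-μ : ∀ {a b X Y} → sup a ≡ X → sup b ≡ Y → Disjoint X Y → sup (μ a b) ≡ X ∪ Y
  sup-μ refl refl X#Y = μ-sup _ _ X#Y

  Δ-μ : ∀ {a b X Y} → sup a ≡ X → sup b ≡ Y → Disjoint X Y → Δ X Y (μ a b) ≡ just (a , b)
  Δ-μ {a} {b} refl refl a#b = begin
    Δ (sup a) (sup b) (μ a b)
      ≡⟨ compat a b (sup a) (sup b) a#b (a#b , refl) ⟩
    ⊗μ μ (Δ (sup a ∩ sup a) (sup a ∩ sup b) a) (Δ (sup b ∩ sup a) (sup b ∩ sup b) b)
      ≡⟨ cong₂ (⊗μ μ) (cong₂ (λ S T → Δ S T a) (∩-idem (sup a)) a#b)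
                      (cong₂ (λ S T → Δ S T b) (Disjoint-sym a#b) (∩-idem (sup b))) ⟩
    ⊗μ μ (Δ (sup a) ⊥ a) (Δ ⊥ (sup b) b)
      ≡⟨ cong₂ (⊗μ μ) (Δ-counitʳ a) (Δ-counitˡ b) ⟩
    just (μ a one , μ one b)
      ≡⟨ cong just (cong₂ _,_ (μ-unitʳ a) (μ-unitˡ b)) ⟩
    just (a , b) ∎
    where open ≡-Reasoning

  Δ-coassoc-++ : ∀ X Xs Ys {w} → AllPairs Disjoint (X ∷ Xs ++ Ys) → ⋃ (X ∷ Xs ++ Ys) ≡ sup w →
                 Δ⊗id (Δ X (⋃ Xs)) (Δ (⋃ (X ∷ Xs)) (⋃ Ys) w) ≡
                 id⊗Δ (Δ (⋃ Xs) (⋃ Ys)) (Δ X (⋃ (Xs ++ Ys)) w)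
  Δ-coassoc-++ X Xs Ys {w} (X# ∷ pd) ⋃≡ =
    trans (Δ-coassoc X (⋃ Xs) (⋃ Ys) w
             (Disjoint-⋃ʳ (All.++⁻ˡ Xs X#)) (Disjoint-⋃ʳ (All.++⁻ʳ Xs X#)) (Disjoint-⋃-++ Xs pd)
             (trans (cong (X ∪_) (sym (⋃-++ Xs Ys))) ⋃≡))
          (cong (λ S → id⊗Δ (Δ (⋃ Xs) (⋃ Ys)) (Δ X S w)) (sym (⋃-++ Xs Ys)))

  Δ-⋃-sup : ∀ Xs {Ys w u v} → AllPairs Disjoint (Xs ++ Ys) → ⋃ (Xs ++ Ys) ≡ sup w →
            Δ (⋃ Xs) (⋃ Ys) w ≡ just (u , v) → sup u ≡ ⋃ Xs × sup v ≡ ⋃ Ys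
  Δ-⋃-sup Xs {Ys} pd ⋃≡ =
    Δ-sup _ _ _ _ _ (Disjoint-⋃-++ Xs pd , trans (sym (⋃-++ Xs Ys)) ⋃≡)

  -- ΔL treats a one-part composition separately; under the support hypothesis
  -- the counit makes the general recursion valid for it as well.
  ΔL-∷⁺ : ∀ {A} As {x u v us} → A ∪ ⋃ As ≡ sup x →
          Δ A (⋃ As) x ≡ just (u , v) → ΔL M As v ≡ just us → ΔL M (A ∷ As) x ≡ just (u ∷ us)
  ΔL-∷⁺ {A} [] ⋃≡ Δx≡ refl =
    cong (λ z → just (z ∷ []))
      (,-injectiveˡ (just-injective (trans (sym (Δ-counitʳ′ (trans (sym (∪-identityʳ A)) ⋃≡))) Δx≡)))
  ΔL-∷⁺ (_ ∷ _) _ Δx≡ Δv≡ rewrite Δx≡ | Δv≡ = refl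

  ΔL-∷⁻ : ∀ {A} As {x ls} → A ∪ ⋃ As ≡ sup x → ΔL M (A ∷ As) x ≡ just ls →
          ∃[ u ] ∃[ v ] ∃[ us ] Δ A (⋃ As) x ≡ just (u , v) × ΔL M As v ≡ just us × ls ≡ u ∷ us
  ΔL-∷⁻ {A} [] {x} ⋃≡ refl =
    x , one , [] , Δ-counitʳ′ (trans (sym (∪-identityʳ A)) ⋃≡) , refl , refl
  ΔL-∷⁻ {A} As@(_ ∷ _) {x} _ eq with Δ A (⋃ As) x in Δx≡
  ... | just (u , v) with ΔL M As v in Δv≡
  ...   | just us with eq
  ...     | refl = u , v , us , refl , Δv≡ , refl

  ΔL-++⁻ : ∀ Xs {Ys w ls} → AllPairs Disjoint (Xs ++ Ys) → ⋃ (Xs ++ Ys) ≡ sup w →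
           ΔL M (Xs ++ Ys) w ≡ just ls →
           ∃[ u ] ∃[ v ] ∃[ us ] ∃[ vs ] Δ (⋃ Xs) (⋃ Ys) w ≡ just (u , v) ×
             ΔL M Xs u ≡ just us × ΔL M Ys v ≡ just vs × ls ≡ us ++ vs
  ΔL-++⁻ [] {w = w} {ls} _ ⋃≡ Δw≡ = one , w , [] , ls , Δ-counitˡ′ ⋃≡ , refl , Δw≡ , refl
  ΔL-++⁻ (X ∷ Xs) {Ys} {w} pd@(X# ∷ pd′) ⋃≡ Δw≡
    with ΔL-∷⁻ (Xs ++ Ys) ⋃≡ Δw≡
  ... | a , q , ls′ , Δw≡aq , Δq≡ , refl
    with ΔL-++⁻ Xs pd′ (sym (proj₂ (Δ-sup _ _ _ _ _ (Disjoint-⋃ʳ X# , ⋃≡) Δw≡aq))) Δq≡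
  ...   | u′ , v , us′ , vs , Δq≡u′v , Δu′≡ , Δv≡ , refl
    with Δ⊗id-just⁻ (Δ X (⋃ Xs))
           (trans (Δ-coassoc-++ X Xs Ys pd ⋃≡) (id⊗Δ-just⁺ (Δ (⋃ Xs) (⋃ Ys)) Δw≡aq Δq≡u′v))
  ...     | p , Δw≡pv , Δp≡au′ =
    p , v , a ∷ us′ , vs , Δw≡pv ,
    ΔL-∷⁺ Xs (sym (proj₁ (Δ-⋃-sup (X ∷ Xs) pd ⋃≡ Δw≡pv))) Δp≡au′ Δu′≡ , Δv≡ , refl

  ΔL-++⁺ : ∀ Xs {Ys w u v us vs} → AllPairs Disjoint (Xs ++ Ys) → ⋃ (Xs ++ Ys) ≡ sup w →
           Δ (⋃ Xs) (⋃ Ys) w ≡ just (u , v) → ΔL M Xs u ≡ just us → ΔL M Ys v ≡ just vs →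
           ΔL M (Xs ++ Ys) w ≡ just (us ++ vs)
  ΔL-++⁺ [] {Ys} {vs = vs} _ ⋃≡ Δw≡ refl Δv≡ =
    subst (λ z → ΔL M Ys z ≡ just vs)
      (,-injectiveʳ (just-injective (trans (sym Δw≡) (Δ-counitˡ′ ⋃≡)))) Δv≡
  ΔL-++⁺ (X ∷ Xs) {Ys} pd@(X# ∷ pd′) ⋃≡ Δw≡ Δu≡ Δv≡
    with ΔL-∷⁻ Xs (sym (proj₁ (Δ-⋃-sup (X ∷ Xs) pd ⋃≡ Δw≡))) Δu≡
  ... | a , u′ , us′ , Δu≡au′ , Δu′≡ , refl
    with id⊗Δ-just⁻ (Δ (⋃ Xs) (⋃ Ys))
           (trans (sym (Δ-coassoc-++ X Xs Ys pd ⋃≡)) (Δ⊗id-just⁺ (Δ X (⋃ Xs)) Δw≡ Δu≡au′))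
  ...   | q , Δw≡aq , Δq≡u′v =
    ΔL-∷⁺ (Xs ++ Ys) ⋃≡ Δw≡aq
      (ΔL-++⁺ Xs pd′ (sym (proj₂ (Δ-sup _ _ _ _ _ (Disjoint-⋃ʳ X# , ⋃≡) Δw≡aq))) Δq≡u′v Δu′≡ Δv≡)

  ΔL-sup : ∀ As {w us} → AllPairs Disjoint As → ⋃ As ≡ sup w → ΔL M As w ≡ just us → map sup us ≡ As
  ΔL-sup []       _          _  refl = refl
  ΔL-sup (A ∷ As) (A# ∷ pd) ⋃≡ Δw≡ with ΔL-∷⁻ As ⋃≡ Δw≡
  ... | u , v , us , Δw≡uv , Δv≡ , refl with Δ-sup _ _ _ _ _ (Disjoint-⋃ʳ A# , ⋃≡) Δw≡uv
  ...   | sup-u , sup-v = cong₂ _∷_ sup-u (ΔL-sup As pd (sym sup-v) Δv≡)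

  -- Splits r bs ls: along the refinement r : Λ ≤C B, the coproduct of each
  -- entry of bs over the parts of Λ it is made of is the matching block of ls.
  data Splits : {Λ B : List (Subset n)} → Λ ≤C B → List H → List H → Set where
    []  : Splits [] [] []
    _∷_ : ∀ {C Cs As Bs} {Λ≤B : As ≤C Bs} {b bs ps ls} →
          ΔL M (C ∷ Cs) b ≡ just ps → Splits Λ≤B bs ls → Splits (step C Cs Λ≤B) (b ∷ bs) (ps ++ ls)

  ΔL-coarsen : ∀ {Λ B} (Λ≤B : Λ ≤C B) {w ls} → AllPairs Disjoint Λ → ⋃ Λ ≡ sup w →
               ΔL M Λ w ≡ just ls → ∃[ bs ] ΔL M B w ≡ just bs × Splits Λ≤B bs ls
  ΔL-coarsen [] _ _ refl = [] , refl , []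
  ΔL-coarsen (step C Cs {As} {Bs} Λ≤B) {w} pd ⋃≡ Δw≡
    with ΔL-++⁻ (C ∷ Cs) pd ⋃≡ Δw≡
  ... | u , v , ps , ls , Δw≡uv , Δu≡ , Δv≡ , refl
    with ΔL-coarsen Λ≤B (AllPairs-++⁻ʳ (C ∷ Cs) pd) (sym (proj₂ (Δ-⋃-sup (C ∷ Cs) pd ⋃≡ Δw≡uv))) Δv≡
  ...   | bs , Δv≡bs , split =
    u ∷ bs ,
    ΔL-∷⁺ Bs (trans (≤C-⋃ (step C Cs Λ≤B)) ⋃≡)
          (subst (λ S → Δ (⋃ (C ∷ Cs)) S w ≡ just (u , v)) (sym (≤C-⋃ Λ≤B)) Δw≡uv) Δv≡bs ,
    Δu≡ ∷ split

  μL-∷ : ∀ a us → μL M (a ∷ us) ≡ μ a (μL M us)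
  μL-∷ a []      = sym (μ-unitʳ a)
  μL-∷ a (_ ∷ _) = refl

  sup-μL : ∀ us → AllPairs Disjoint (map sup us) → sup (μL M us) ≡ ⋃ (map sup us)
  sup-μL []       _         = sup-one
  sup-μL (u ∷ us) (u# ∷ pd) = trans (cong sup (μL-∷ u us)) (sup-μ refl (sup-μL us pd) (Disjoint-⋃ʳ u#))

  μL-++ : ∀ us vs → AllPairs Disjoint (map sup us ++ map sup vs) →
          μL M (us ++ vs) ≡ μ (μL M us) (μL M vs)
  μL-++ []       vs _         = sym (μ-unitˡ (μL M vs))
  μL-++ (u ∷ us) vs (u# ∷ pd) = begin
    μL M (u ∷ us ++ vs)            ≡⟨ μL-∷ u (us ++ vs) ⟩
    μ u (μL M (us ++ vs))          ≡⟨ cong (μ u) (μL-++ us vs pd) ⟩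
    μ u (μ (μL M us) (μL M vs))    ≡⟨ μ-assoc u (μL M us) (μL M vs) u#us u#vs us#vs ⟨
    μ (μ u (μL M us)) (μL M vs)    ≡⟨ cong (λ z → μ z (μL M vs)) (μL-∷ u us) ⟨
    μ (μL M (u ∷ us)) (μL M vs)    ∎
    where
    open ≡-Reasoning
    sup-us = sup-μL us (AllPairs-++⁻ˡ (map sup us) pd)
    sup-vs = sup-μL vs (AllPairs-++⁻ʳ (map sup us) pd)
    u#us = subst (Disjoint (sup u)) (sym sup-us) (Disjoint-⋃ʳ (All.++⁻ˡ (map sup us) u#))
    u#vs = subst (Disjoint (sup u)) (sym sup-vs) (Disjoint-⋃ʳ (All.++⁻ʳ (map sup us) u#))
    us#vs = subst₂ Disjoint (sym sup-us) (sym sup-vs) (Disjoint-⋃-++ (map sup us) pd)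

  ΔL-μL : ∀ us → AllPairs Disjoint (map sup us) → ΔL M (map sup us) (μL M us) ≡ just us
  ΔL-μL []       _         = refl
  ΔL-μL (u ∷ us) (u# ∷ pd) =
    subst (λ z → ΔL M (map sup (u ∷ us)) z ≡ just (u ∷ us)) (sym (μL-∷ u us))
      (ΔL-∷⁺ (map sup us) (sym (sup-μ refl sup-us u#us)) (Δ-μ refl sup-us u#us) (ΔL-μL us pd))
    where
    sup-us = sup-μL us pd
    u#us = Disjoint-⋃ʳ u#

  ΔL-μL-split : ∀ {Λ B} {Λ≤B : Λ ≤C B} {bs ls} → Splits Λ≤B bs ls →
                AllPairs Disjoint Λ → AllPairs Disjoint B → map sup bs ≡ B → ΔL M Λ (μL M bs) ≡ just ls
  ΔL-μL-split [] _ _ _ = refl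
  ΔL-μL-split (_∷_ {C} {Cs} {As} {Bs} {Λ≤B} {b} {bs} {ps} {ls} Δb≡ split) pdΛ (_ ∷ pdB) sups =
    subst (λ z → ΔL M ((C ∷ Cs) ++ As) z ≡ just (ps ++ ls)) (sym (μL-∷ b bs))
      (ΔL-++⁺ (C ∷ Cs) pdΛ (trans (⋃-++ (C ∷ Cs) As) (sym (sup-μ sup-b sup-bs b#bs)))
        (Δ-μ sup-b sup-bs b#bs) Δb≡
        (ΔL-μL-split split (AllPairs-++⁻ʳ (C ∷ Cs) pdΛ) pdB sups′))
    where
    sup-b = proj₁ (∷-injective sups)
    sups′ = proj₂ (∷-injective sups)
    sup-bs : sup (μL M bs) ≡ ⋃ As
    sup-bs = trans (sup-μL bs (subst (AllPairs Disjoint) (sym sups′) pdB))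
                   (trans (cong ⋃ sups′) (≤C-⋃ Λ≤B))
    b#bs = Disjoint-⋃-++ (C ∷ Cs) pdΛ

  μL-coarsen : ∀ {Λ B} (Λ≤B : Λ ≤C B) ls → map sup ls ≡ Λ → AllPairs Disjoint Λ →
               ∃[ gs ] map sup gs ≡ B × μL M gs ≡ μL M ls
  μL-coarsen [] [] _ _ = [] , refl , refl
  μL-coarsen (step C Cs {As} Λ≤B) ls sups pd
    with map-++⁻ sup ls (C ∷ Cs) As sups
  ... | ps , ls′ , refl , sup-ps , sup-ls′
    with μL-coarsen Λ≤B ls′ sup-ls′ (AllPairs-++⁻ʳ (C ∷ Cs) pd)
  ...   | gs , sup-gs , μgs≡ =
    μL M ps ∷ gs ,
    cong₂ _∷_ (trans (sup-μL ps pd-ps) (cong ⋃ sup-ps)) sup-gs ,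
    (begin
      μL M (μL M ps ∷ gs)      ≡⟨ μL-∷ (μL M ps) gs ⟩
      μ (μL M ps) (μL M gs)    ≡⟨ cong (μ (μL M ps)) μgs≡ ⟩
      μ (μL M ps) (μL M ls′)   ≡⟨ μL-++ ps ls′ pd-ls ⟨
      μL M (ps ++ ls′)         ∎)
    where
    open ≡-Reasoning
    pd-ps = subst (AllPairs Disjoint) (sym sup-ps) (AllPairs-++⁻ˡ (C ∷ Cs) pd)
    pd-ls = subst (AllPairs Disjoint) (sym (cong₂ _++_ sup-ps sup-ls′)) pd

  ΔL-μL-ΔL : ∀ {B A} (B≤A : B ≤C A) {x bs as} → AllPairs Disjoint B → AllPairs Disjoint A →
             ⋃ B ≡ sup x → ΔL M B x ≡ just bs → ΔL M A x ≡ just as → ΔL M B (μL M as) ≡ just bs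
  ΔL-μL-ΔL {A = A} B≤A pdB pdA ⋃≡ Δx≡bs Δx≡as with ΔL-coarsen B≤A pdB ⋃≡ Δx≡bs
  ... | as′ , Δx≡as′ , split with trans (sym Δx≡as′) Δx≡as
  ...   | refl = ΔL-μL-split split pdB pdA (ΔL-sup A pdA (trans (≤C-⋃ B≤A) ⋃≡) Δx≡as)

  ΔL-μL-coarser : ∀ {Λ B} (Λ≤B : Λ ≤C B) {ls} → AllPairs Disjoint Λ → AllPairs Disjoint B →
                  map sup ls ≡ Λ → ∃[ gs ] ΔL M B (μL M ls) ≡ just gs × μL M gs ≡ μL M ls
  ΔL-μL-coarser Λ≤B {ls} pdΛ pdB sups with μL-coarsen Λ≤B ls sups pdΛ
  ... | gs , refl , μgs≡ =
    gs , subst (λ z → ΔL M (map sup gs) z ≡ just gs) μgs≡ (ΔL-μL gs pdB) , μgs≡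

lemma3p4 : (n : ℕ) (M : LinHopf n) (I : Subset n) (x y : LinHopf.H M) →
           LinHopf.sup M x ≡ I → LinHopf.sup M y ≡ I →
           (A Λ : List (Subset n)) → InC M x y A → MinimalC M x y Λ →
           (B : List (Subset n)) → IsComposition I B → Λ ≤C B → B ≤C A →
           InC M x y B
lemma3p4 n M I x y refl _ A Λ ((_ , pdA , _) , as , Δx≡as , μas≡y)
         (((_ , pdΛ , ⋃Λ≡) , ls , Δx≡ls , μls≡y) , _) B B-comp@(_ , pdB , ⋃B≡) Λ≤B B≤A
  with ΔL-coarsen M Λ≤B pdΛ ⋃Λ≡ Δx≡ls
... | bs , Δx≡bs , _
  with ΔL-μL-coarser M Λ≤B pdΛ pdB (ΔL-sup M Λ pdΛ ⋃Λ≡ Δx≡ls)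
...   | gs , Δμls≡gs , μgs≡μls = B-comp , bs , Δx≡bs , μbs≡y
  where
  open ≡-Reasoning
  Δy≡bs : ΔL M B y ≡ just bs
  Δy≡bs = subst (λ z → ΔL M B z ≡ just bs) μas≡y (ΔL-μL-ΔL M B≤A pdB pdA ⋃B≡ Δx≡bs Δx≡as)
  Δy≡gs : ΔL M B y ≡ just gs
  Δy≡gs = subst (λ z → ΔL M B z ≡ just gs) μls≡y Δμls≡gs
  μbs≡y : μL M bs ≡ y
  μbs≡y = begin
    μL M bs  ≡⟨ cong (μL M) (just-injective (trans (sym Δy≡bs) Δy≡gs)) ⟩
    μL M gs  ≡⟨ μgs≡μls ⟩
    μL M ls  ≡⟨ μls≡y ⟩
    y        ∎
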